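{- If there exists a set of $\mu$ transversals of $B_n$ that intersect stably in $t$ points, then there exists a circulant $\mu$-way $(n-t)$-homogeneous latin trade of order $n$.
   Context: Rows, columns and symbols are indexed by $[0,n-1]=\{0,\ldots,n-1\}$ and taken modulo $n$. $B_n = \{(r,c,r+c \bmod n) : r,c \in [0,n-1]\}$, where a triple $(r,c,e)$ means cell $(r,c)$ contains symbol $e$. A transversal of $B_n$ is a set of $n$ triples of $B_n$ containing each row, each column and each symbol exactly once. A collection of $\mu$ transversals $T_1,\ldots,T_\mu$ intersects stably in $t$ points if, with $S=\bigcap_{i=1}^\mu T_i$, $|S|=t$ and $(T_i\cap T_j)\setminus S=\emptyset$ for all $1\le i<j\le\mu$. A partial latin square of order $n$ is an $n\times n$ array whose cells are empty or contain a symbol from $[0,n-1]$, each symbol at most once per row and column, viewed as a set of triples. A $\mu$-way latin trade of volume $s$ and order $n$ is a collection $(L_1,\ldots,L_\mu)$ of partial latin squares of order $n$ such that: each $L_\alpha$ has exactly the same set of $s$ filled cells; each filled cell contains a different symbol in each of the $\mu$ partial latin squares; and for each row (resp. column), the set of symbols in that row (resp. column) is the same in all $\mu$ partial latin squares. It is circulant if for each $\alpha$, $(r,c,e)\in L_\alpha$ implies $(r+1,c+1,e+1)\in L_\alpha$ (mod $n$). It is $k$-homogeneous if in each $L_\alpha$ every row and every column contains exactly $k$ filled cells and every symbol appears in exactly $k$ filled cells. -}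

module Defs where

open import Data.Nat using (ℕ; zero; suc; _+_; _≥_)
open import Data.Nat.DivMod using (_%_; m%n<n)
open import Data.Fin using (Fin; zero; suc; toℕ; fromℕ<; _≟_)
open import Data.Bool using (Bool; true; false; if_then_else_; _∧_; _∨_)
open import Data.Product using (Σ; _×_; _,_)
open import Relation.Nullary using (¬_)
open import Relation.Nullary.Decidable using (⌊_⌋)
open import Relation.Binary.PropositionalEquality using (_≡_; _≢_)

_⊕_ : ∀ {n} → Fin n → Fin n → Fin n
_⊕_ {suc k} i j = fromℕ< (m%n<n (toℕ i + toℕ j) (suc k))

inc : ∀ {n} → Fin n → Fin n
inc {suc k} i = fromℕ< (m%n<n (suc (toℕ i)) (suc k))

countF : ∀ {m} → (Fin m → Bool) → ℕ
countF {zero}  p = 0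
countF {suc m} p = (if p zero then 1 else 0) + countF (λ i → p (suc i))

sumF : ∀ {m} → (Fin m → ℕ) → ℕ
sumF {zero}  f = 0
sumF {suc m} f = f zero + sumF (λ i → f (suc i))

anyF : ∀ {m} → (Fin m → Bool) → Bool
anyF {zero}  p = false
anyF {suc m} p = p zero ∨ anyF (λ i → p (suc i))

allF : ∀ {m} → (Fin m → Bool) → Bool
allF {zero}  p = true
allF {suc m} p = p zero ∧ allF (λ i → p (suc i))

TSet : ℕ → Set
TSet n = Fin n → Fin n → Fin n → Bool

_∋_ : ∀ {n} → TSet n → Fin n × Fin n × Fin n → Set
S ∋ (r , c , e) = S r c e ≡ true

_⊆_ : ∀ {n} → TSet n → TSet n → Set
S ⊆ T = ∀ r c e → S ∋ (r , c , e) → T ∋ (r , c , e)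

card : ∀ {n} → TSet n → ℕ
card S = sumF λ r → sumF λ c → countF λ e → S r c e

rowCount : ∀ {n} → TSet n → Fin n → ℕ
rowCount S r = sumF λ c → countF λ e → S r c e

colCount : ∀ {n} → TSet n → Fin n → ℕ
colCount S c = sumF λ r → countF λ e → S r c e

symCount : ∀ {n} → TSet n → Fin n → ℕ
symCount S e = sumF λ r → countF λ c → S r c e

B : (n : ℕ) → TSet n
B n r c e = ⌊ e ≟ (r ⊕ c) ⌋

IsTransversal : (n : ℕ) → TSet n → Set
IsTransversal n T =
  (T ⊆ B n) × (card T ≡ n) ×
  (∀ r → rowCount T r ≡ 1) × (∀ c → colCount T c ≡ 1) × (∀ e → symCount T e ≡ 1)

⋂ : ∀ {μ n} → (Fin μ → TSet n) → TSet n
⋂ T r c e = allF λ i → T i r c e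

IntersectStably : ∀ {μ n} → (Fin μ → TSet n) → ℕ → Set
IntersectStably T t =
  (card (⋂ T) ≡ t) ×
  (∀ i j → i ≢ j → ∀ r c e →
     T i ∋ (r , c , e) → T j ∋ (r , c , e) → ⋂ T ∋ (r , c , e))

IsPartialLatinSquare : (n : ℕ) → TSet n → Set
IsPartialLatinSquare n L =
  (∀ r c → countF (λ e → L r c e) Data.Nat.≤ 1) ×
  (∀ r e → countF (λ c → L r c e) Data.Nat.≤ 1) ×
  (∀ c e → countF (λ r → L r c e) Data.Nat.≤ 1)

filled : ∀ {n} → TSet n → Fin n → Fin n → Bool
filled L r c = anyF λ e → L r c e

rowHas : ∀ {n} → TSet n → Fin n → Fin n → Bool
rowHas L r e = anyF λ c → L r c e

colHas : ∀ {n} → TSet n → Fin n → Fin n → Bool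
colHas L c e = anyF λ r → L r c e

IsLatinTrade : (μ n s : ℕ) → (Fin μ → TSet n) → Set
IsLatinTrade μ n s L =
  (∀ α → IsPartialLatinSquare n (L α)) ×
  (∀ α β r c → filled (L α) r c ≡ filled (L β) r c) ×
  (∀ α → (sumF λ r → countF λ c → filled (L α) r c) ≡ s) ×
  (∀ α β → α ≢ β → ∀ r c e → L α ∋ (r , c , e) → L β r c e ≡ false) ×
  (∀ α β r e → rowHas (L α) r e ≡ rowHas (L β) r e) ×
  (∀ α β c e → colHas (L α) c e ≡ colHas (L β) c e)

IsCirculant : ∀ {μ n} → (Fin μ → TSet n) → Set
IsCirculant L =
  ∀ α r c e → L α ∋ (r , c , e) → L α ∋ (inc r , inc c , inc e)

IsHomogeneous : ∀ {μ n} → ℕ → (Fin μ → TSet n) → Set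
IsHomogeneous k L =
  ∀ α → (∀ r → (countF λ c → filled (L α) r c) ≡ k) ×
        (∀ c → (countF λ r → filled (L α) r c) ≡ k) ×
        (∀ e → symCount (L α) e ≡ k)

-- Let S be the common intersection and D_α = T_α ∖ S. Each T_α meets every row, column and
-- symbol of B_n exactly once and contains S, so the rows (columns, symbols) met by D_α are
-- exactly those missed by S: the same for every α, and n − t of them. Stability makes the D_α
-- pairwise disjoint. Develop D_α cyclically into L_α = {(r , r + a , r + x) : (a , b , x) ∈ D_α}.
-- Then cell (r , c) of L_α is filled iff c − r is a row of D_α, symbol e occurs in row r iff
-- e − r is a symbol of D_α, and in column c iff e − c is a column of D_α, so the trade conditions
-- and (n − t)-homogeneity are inherited from these facts about the D_α.

module Submission where

open import Defs
open import Data.Nat using (ℕ; zero; suc; _+_; _*_; _∸_; _≤_; z≤n; NonZero)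
open import Data.Nat.Properties
  using (+-comm; +-assoc; +-suc; +-identityʳ; ≤-refl; ≤-trans; ≤-reflexive; ≤-pred; +-mono-≤;
         m≤m+n; m≤n+m; 1+n≰n; n≤0⇒n≡0; m+n∸m≡n; m∸n+n≡m; <⇒≤; +-0-commutativeMonoid)
open import Data.Nat.DivMod using (_%_; m%n<n; m%n%n≡m%n; %-distribˡ-+; n%n≡0; m<n⇒m%n≡m)
open import Data.Fin using (Fin; zero; suc; toℕ; fromℕ<; _≟_)
open import Data.Fin.Properties using (toℕ-fromℕ<; toℕ-injective; toℕ<n; suc-injective; 0≢1+n)
open import Data.Fin.Permutation using (permutation)
open import Data.Bool using (Bool; true; false; _∧_; not; if_then_else_)
open import Data.Bool.Properties using (⇔→≡; ∨-zeroʳ; ∧-zeroʳ; ¬-not)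
open import Data.Product using (Σ; ∃; ∃₂; _×_; _,_; proj₁; proj₂)
open import Data.Empty using (⊥; ⊥-elim)
open import Function using (_∘_; case_of_; mk⇔)
open import Relation.Nullary using (yes)
open import Relation.Binary.PropositionalEquality
import Algebra.Properties.CommutativeMonoid.Sum as CommutativeMonoidSum

private module ∑ = CommutativeMonoidSum +-0-commutativeMonoid

open ≡-Reasoning

indicator : Bool → ℕ
indicator b = if b then 1 else 0

sumF≡∑ : ∀ {m} (f : Fin m → ℕ) → sumF f ≡ ∑.sum f
sumF≡∑ {zero}  f = refl
sumF≡∑ {suc m} f = cong (f zero +_) (sumF≡∑ (f ∘ suc))

sumF-cong : ∀ {m} {f g : Fin m → ℕ} → (∀ i → f i ≡ g i) → sumF f ≡ sumF g
sumF-cong {f = f} {g} f≗g = trans (sumF≡∑ f) (trans (∑.sum-cong-≗ f≗g) (sym (sumF≡∑ g)))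

sumF-comm : ∀ {m m′} (f : Fin m → Fin m′ → ℕ) →
            sumF (λ i → sumF (f i)) ≡ sumF (λ j → sumF (λ i → f i j))
sumF-comm f = trans (sumF₂≡∑₂ f) (trans (∑.∑-comm f) (sym (sumF₂≡∑₂ (λ j i → f i j))))
  where
  sumF₂≡∑₂ : ∀ {m m′} (g : Fin m → Fin m′ → ℕ) → sumF (λ i → sumF (g i)) ≡ ∑.sum (λ i → ∑.sum (g i))
  sumF₂≡∑₂ g = trans (sumF-cong (sumF≡∑ ∘ g)) (sumF≡∑ (λ i → ∑.sum (g i)))

sumF-permute : ∀ {m} (f : Fin m → ℕ) (π π⁻¹ : Fin m → Fin m) →
               (∀ i → π (π⁻¹ i) ≡ i) → (∀ i → π⁻¹ (π i) ≡ i) → sumF (f ∘ π) ≡ sumF f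
sumF-permute f π π⁻¹ ππ⁻¹ π⁻¹π = begin
  sumF (f ∘ π)   ≡⟨ sumF≡∑ (f ∘ π) ⟩
  ∑.sum (f ∘ π)  ≡⟨ ∑.sum-permute f (permutation π π⁻¹ ππ⁻¹ π⁻¹π) ⟨
  ∑.sum f        ≡⟨ sumF≡∑ f ⟨
  sumF f         ∎

sumF-const : ∀ {m} c → sumF {m} (λ _ → c) ≡ m * c
sumF-const {zero}  c = refl
sumF-const {suc m} c = cong (c +_) (sumF-const {m} c)

≤-sumF : ∀ {m} (f : Fin m → ℕ) i → f i ≤ sumF f
≤-sumF f zero    = m≤m+n _ _
≤-sumF f (suc i) = ≤-trans (≤-sumF (f ∘ suc) i) (m≤n+m _ _)

sumF-mono : ∀ {m} {f g : Fin m → ℕ} → (∀ i → f i ≤ g i) → sumF f ≤ sumF g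
sumF-mono {zero}  f≤g = z≤n
sumF-mono {suc m} f≤g = +-mono-≤ (f≤g zero) (sumF-mono (f≤g ∘ suc))

countF≡sumF-indicator : ∀ {m} (p : Fin m → Bool) → countF p ≡ sumF (indicator ∘ p)
countF≡sumF-indicator {zero}  p = refl
countF≡sumF-indicator {suc m} p = cong (indicator (p zero) +_) (countF≡sumF-indicator (p ∘ suc))

countF-cong : ∀ {m} {p q : Fin m → Bool} → (∀ i → p i ≡ q i) → countF p ≡ countF q
countF-cong {zero}  p≗q = refl
countF-cong {suc m} p≗q = cong₂ _+_ (cong indicator (p≗q zero)) (countF-cong (p≗q ∘ suc))

countF-permute : ∀ {m} (p : Fin m → Bool) (π π⁻¹ : Fin m → Fin m) →
                 (∀ i → π (π⁻¹ i) ≡ i) → (∀ i → π⁻¹ (π i) ≡ i) → countF (p ∘ π) ≡ countF p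
countF-permute p π π⁻¹ ππ⁻¹ π⁻¹π = begin
  countF (p ∘ π)             ≡⟨ countF≡sumF-indicator (p ∘ π) ⟩
  sumF (indicator ∘ p ∘ π)   ≡⟨ sumF-permute (indicator ∘ p) π π⁻¹ ππ⁻¹ π⁻¹π ⟩
  sumF (indicator ∘ p)       ≡⟨ countF≡sumF-indicator p ⟨
  countF p                   ∎

countF-mono : ∀ {m} {p q : Fin m → Bool} → (∀ i → p i ≡ true → q i ≡ true) → countF p ≤ countF q
countF-mono {zero}  p⇒q = z≤n
countF-mono {suc m} p⇒q = +-mono-≤ (indicator-mono (p⇒q zero)) (countF-mono (p⇒q ∘ suc))
  where
  indicator-mono : ∀ {a b} → (a ≡ true → b ≡ true) → indicator a ≤ indicator b
  indicator-mono {false}     _   = z≤n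
  indicator-mono {true}  a⇒b rewrite a⇒b refl = ≤-refl

countF-complement : ∀ {m} (p : Fin m → Bool) → countF p + countF (not ∘ p) ≡ m
countF-complement {zero}  p = refl
countF-complement {suc m} p with p zero
... | true  = cong suc (countF-complement (p ∘ suc))
... | false = trans (+-suc _ _) (cong suc (countF-complement (p ∘ suc)))

countF-not : ∀ {m} (p : Fin m → Bool) → countF (not ∘ p) ≡ m ∸ countF p
countF-not {m} p = begin
  countF (not ∘ p)                       ≡⟨ m+n∸m≡n (countF p) _ ⟨
  countF p + countF (not ∘ p) ∸ countF p ≡⟨ cong (_∸ countF p) (countF-complement p) ⟩
  m ∸ countF p                           ∎

anyF-intro : ∀ {m} (p : Fin m → Bool) i → p i ≡ true → anyF p ≡ true
anyF-intro p zero    pi rewrite pi = refl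
anyF-intro p (suc i) pi rewrite anyF-intro (p ∘ suc) i pi = ∨-zeroʳ (p zero)

anyF-elim : ∀ {m} (p : Fin m → Bool) → anyF p ≡ true → ∃ λ i → p i ≡ true
anyF-elim {suc m} p any with p zero in p0
... | true  = zero , p0
... | false = let i , pi = anyF-elim (p ∘ suc) any in suc i , pi

allF-elim : ∀ {m} (p : Fin m → Bool) → allF p ≡ true → ∀ i → p i ≡ true
allF-elim {suc m} p all i with p zero in p0
allF-elim {suc m} p all zero    | true = p0
allF-elim {suc m} p all (suc i) | true = allF-elim (p ∘ suc) all i

1≤countF : ∀ {m} (p : Fin m → Bool) i → p i ≡ true → 1 ≤ countF p
1≤countF p zero    pi rewrite pi = m≤m+n 1 _
1≤countF p (suc i) pi = ≤-trans (1≤countF (p ∘ suc) i pi) (m≤n+m _ _)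

countF-head : ∀ {m} (p : Fin (suc m) → Bool) → p zero ≡ true → countF p ≡ suc (countF (p ∘ suc))
countF-head p p0 rewrite p0 = refl

countF≤1⇒unique : ∀ {m} (p : Fin m → Bool) → countF p ≤ 1 →
                  ∀ {i j} → p i ≡ true → p j ≡ true → i ≡ j
countF≤1⇒unique p p≤1 {zero}  {zero}  pi pj = refl
countF≤1⇒unique p p≤1 {zero}  {suc j} pi pj =
  ⊥-elim (1+n≰n (≤-trans (1≤countF (p ∘ suc) j pj) (≤-pred (subst (_≤ 1) (countF-head p pi) p≤1))))
countF≤1⇒unique p p≤1 {suc i} {zero}  pi pj =
  ⊥-elim (1+n≰n (≤-trans (1≤countF (p ∘ suc) i pi) (≤-pred (subst (_≤ 1) (countF-head p pj) p≤1))))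
countF≤1⇒unique p p≤1 {suc i} {suc j} pi pj =
  cong suc (countF≤1⇒unique (p ∘ suc) (≤-trans (m≤n+m _ _) p≤1) pi pj)

unique⇒countF≤1 : ∀ {m} (p : Fin m → Bool) → (∀ i j → p i ≡ true → p j ≡ true → i ≡ j) → countF p ≤ 1
unique⇒countF≤1 {zero}  p unique = z≤n
unique⇒countF≤1 {suc m} p unique with p zero in p0
... | true  = ≤-reflexive (cong suc (countF-none (p ∘ suc) λ i pi → 0≢1+n (unique zero (suc i) p0 pi)))
  where
  countF-none : ∀ {m} (q : Fin m → Bool) → (∀ i → q i ≢ true) → countF q ≡ 0
  countF-none {zero}  q none = refl
  countF-none {suc m} q none rewrite ¬-not (none zero) = countF-none (q ∘ suc) (none ∘ suc)
... | false = unique⇒countF≤1 (p ∘ suc) λ i j pi pj → suc-injective (unique (suc i) (suc j) pi pj)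

countF≤1⇒≡indicator : ∀ {m} (p : Fin m → Bool) → countF p ≤ 1 → countF p ≡ indicator (anyF p)
countF≤1⇒≡indicator {zero}  p p≤1 = refl
countF≤1⇒≡indicator {suc m} p p≤1 with p zero
... | true  = cong suc (n≤0⇒n≡0 (≤-pred p≤1))
... | false = countF≤1⇒≡indicator (p ∘ suc) p≤1

count₂ : ∀ {m m′} → (Fin m → Fin m′ → Bool) → ℕ
count₂ P = sumF λ i → countF (P i)

any₂ : ∀ {m m′} → (Fin m → Fin m′ → Bool) → Bool
any₂ P = anyF λ i → anyF (P i)

any₂-intro : ∀ {m m′} (P : Fin m → Fin m′ → Bool) i j → P i j ≡ true → any₂ P ≡ true
any₂-intro P i j Pij = anyF-intro (λ i → anyF (P i)) i (anyF-intro (P i) j Pij)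

any₂-elim : ∀ {m m′} (P : Fin m → Fin m′ → Bool) → any₂ P ≡ true → ∃₂ λ i j → P i j ≡ true
any₂-elim P any with anyF-elim (λ i → anyF (P i)) any
... | i , anyPi = let j , Pij = anyF-elim (P i) anyPi in i , j , Pij

count₂-mono : ∀ {m m′} {P Q : Fin m → Fin m′ → Bool} →
              (∀ i j → P i j ≡ true → Q i j ≡ true) → count₂ P ≤ count₂ Q
count₂-mono P⇒Q = sumF-mono λ i → countF-mono (P⇒Q i)

module _ {m m′} (P : Fin m → Fin m′ → Bool) (P≤1 : count₂ P ≤ 1) where

  private
    count₂≡countF-anyF : count₂ P ≡ countF (λ i → anyF (P i))
    count₂≡countF-anyF = trans (sumF-cong λ i → countF≤1⇒≡indicator (P i) (≤-trans (≤-sumF _ i) P≤1))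
                         (sym (countF≡sumF-indicator (λ i → anyF (P i))))

    countF-anyF≤1 : countF (λ i → anyF (P i)) ≤ 1
    countF-anyF≤1 = subst (_≤ 1) count₂≡countF-anyF P≤1

  count₂≤1⇒≡indicator : count₂ P ≡ indicator (any₂ P)
  count₂≤1⇒≡indicator = trans count₂≡countF-anyF (countF≤1⇒≡indicator (λ i → anyF (P i)) countF-anyF≤1)

  count₂≤1⇒unique : ∀ {i j i′ j′} → P i j ≡ true → P i′ j′ ≡ true → i ≡ i′ × j ≡ j′
  count₂≤1⇒unique {i} {j} {i′} {j′} Pij Pi′j′
    with countF≤1⇒unique (λ i → anyF (P i)) countF-anyF≤1 (anyF-intro (P i) j Pij) (anyF-intro (P i′) j′ Pi′j′)
  ... | refl = refl , countF≤1⇒unique (P i) (≤-trans (≤-sumF _ i) P≤1) Pij Pi′j′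

count₂≡1⇒any₂ : ∀ {m m′} (P : Fin m → Fin m′ → Bool) → count₂ P ≡ 1 → any₂ P ≡ true
count₂≡1⇒any₂ P P≡1 = indicator≡1 (trans (sym (count₂≤1⇒≡indicator P (≤-reflexive P≡1))) P≡1)
  where
  indicator≡1 : ∀ {b} → indicator b ≡ 1 → b ≡ true
  indicator≡1 {true} _ = refl

module _ {m m′} (P : Fin m → Fin m′ → Bool) (P≡1 : count₂ P ≡ 1) where

  private
    witness : ∃₂ λ i j → P i j ≡ true
    witness = any₂-elim P (count₂≡1⇒any₂ P P≡1)

    i₀ : Fin m
    i₀ = proj₁ witness

    j₀ : Fin m′
    j₀ = proj₁ (proj₂ witness)

    any₂-⊆≡at : (R : Fin m → Fin m′ → Bool) → (∀ i j → R i j ≡ true → P i j ≡ true) → any₂ R ≡ R i₀ j₀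
    any₂-⊆≡at R R⇒P = ⇔→≡ {z = true} (mk⇔ at (any₂-intro R i₀ j₀))
      where
      at : any₂ R ≡ true → R i₀ j₀ ≡ true
      at anyR with any₂-elim R anyR
      ... | i , j , Rij with count₂≤1⇒unique P (≤-reflexive P≡1) (R⇒P i j Rij) (proj₂ (proj₂ witness))
      ... | refl , refl = Rij

  any₂-∖ : (Q : Fin m → Fin m′ → Bool) → (∀ i j → Q i j ≡ true → P i j ≡ true) →
           any₂ (λ i j → P i j ∧ not (Q i j)) ≡ not (any₂ Q)
  any₂-∖ Q Q⇒P = begin
    any₂ (λ i j → P i j ∧ not (Q i j)) ≡⟨ any₂-⊆≡at (λ i j → P i j ∧ not (Q i j)) (λ i j → ∧-elimˡ) ⟩
    P i₀ j₀ ∧ not (Q i₀ j₀)             ≡⟨ cong (_∧ not (Q i₀ j₀)) (proj₂ (proj₂ witness)) ⟩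
    not (Q i₀ j₀)                       ≡⟨ cong not (any₂-⊆≡at Q Q⇒P) ⟨
    not (any₂ Q)                        ∎
    where
    ∧-elimˡ : ∀ {a b} → a ∧ b ≡ true → a ≡ true
    ∧-elimˡ {true} _ = refl

%-absorbˡ : ∀ m o d .{{_ : NonZero d}} → (m % d + o) % d ≡ (m + o) % d
%-absorbˡ m o d = begin
  (m % d + o) % d          ≡⟨ %-distribˡ-+ (m % d) o d ⟩
  (m % d % d + o % d) % d  ≡⟨ cong (λ v → (v + o % d) % d) (m%n%n≡m%n m d) ⟩
  (m % d + o % d) % d      ≡⟨ %-distribˡ-+ m o d ⟨
  (m + o) % d              ∎

%-absorbʳ : ∀ m o d .{{_ : NonZero d}} → (m + o % d) % d ≡ (m + o) % d
%-absorbʳ m o d = begin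
  (m + o % d) % d  ≡⟨ cong (_% d) (+-comm m (o % d)) ⟩
  (o % d + m) % d  ≡⟨ %-absorbˡ o m d ⟩
  (o + m) % d      ≡⟨ cong (_% d) (+-comm o m) ⟩
  (m + o) % d      ∎

module _ {k : ℕ} where

  private
    n : ℕ
    n = suc k

  toℕ-⊕ : (a b : Fin n) → toℕ (a ⊕ b) ≡ (toℕ a + toℕ b) % n
  toℕ-⊕ a b = toℕ-fromℕ< _

  ⊕-assoc : (a b c : Fin n) → (a ⊕ b) ⊕ c ≡ a ⊕ (b ⊕ c)
  ⊕-assoc a b c = toℕ-injective (begin
    toℕ ((a ⊕ b) ⊕ c)                  ≡⟨ toℕ-⊕ (a ⊕ b) c ⟩
    (toℕ (a ⊕ b) + toℕ c) % n          ≡⟨ cong (λ v → (v + toℕ c) % n) (toℕ-⊕ a b) ⟩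
    ((toℕ a + toℕ b) % n + toℕ c) % n  ≡⟨ %-absorbˡ (toℕ a + toℕ b) (toℕ c) n ⟩
    (toℕ a + toℕ b + toℕ c) % n        ≡⟨ cong (_% n) (+-assoc (toℕ a) (toℕ b) (toℕ c)) ⟩
    (toℕ a + (toℕ b + toℕ c)) % n      ≡⟨ %-absorbʳ (toℕ a) (toℕ b + toℕ c) n ⟨
    (toℕ a + (toℕ b + toℕ c) % n) % n  ≡⟨ cong (λ v → (toℕ a + v) % n) (toℕ-⊕ b c) ⟨
    (toℕ a + toℕ (b ⊕ c)) % n          ≡⟨ toℕ-⊕ a (b ⊕ c) ⟨
    toℕ (a ⊕ (b ⊕ c))                  ∎)

  ⊕-comm : (a b : Fin n) → a ⊕ b ≡ b ⊕ a
  ⊕-comm a b = toℕ-injective (begin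
    toℕ (a ⊕ b)          ≡⟨ toℕ-⊕ a b ⟩
    (toℕ a + toℕ b) % n  ≡⟨ cong (_% n) (+-comm (toℕ a) (toℕ b)) ⟩
    (toℕ b + toℕ a) % n  ≡⟨ toℕ-⊕ b a ⟨
    toℕ (b ⊕ a)          ∎)

  ⊕-identityʳ : (a : Fin n) → a ⊕ zero ≡ a
  ⊕-identityʳ a = toℕ-injective (begin
    toℕ (a ⊕ zero)    ≡⟨ toℕ-⊕ a zero ⟩
    (toℕ a + 0) % n   ≡⟨ cong (_% n) (+-identityʳ (toℕ a)) ⟩
    toℕ a % n         ≡⟨ m<n⇒m%n≡m (toℕ<n a) ⟩
    toℕ a             ∎)

  negate : Fin n → Fin n
  negate b = fromℕ< (m%n<n (n ∸ toℕ b) n)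

  ⊕-inverseˡ : (b : Fin n) → (negate b) ⊕ b ≡ zero
  ⊕-inverseˡ b = toℕ-injective (begin
    toℕ ((negate b) ⊕ b)            ≡⟨ toℕ-⊕ (negate b) b ⟩
    (toℕ (negate b) + toℕ b) % n    ≡⟨ cong (λ v → (v + toℕ b) % n) (toℕ-fromℕ< (m%n<n (n ∸ toℕ b) n)) ⟩
    ((n ∸ toℕ b) % n + toℕ b) % n    ≡⟨ %-absorbˡ (n ∸ toℕ b) (toℕ b) n ⟩
    (n ∸ toℕ b + toℕ b) % n          ≡⟨ cong (_% n) (m∸n+n≡m (<⇒≤ (toℕ<n b))) ⟩
    n % n                            ≡⟨ n%n≡0 n ⟩
    0                                ∎)

  _⊖_ : Fin n → Fin n → Fin n
  a ⊖ b = a ⊕ (negate b)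

  ⊖-⊕-cancel : (a b : Fin n) → (a ⊖ b) ⊕ b ≡ a
  ⊖-⊕-cancel a b = begin
    (a ⊕ (negate b)) ⊕ b  ≡⟨ ⊕-assoc a (negate b) b ⟩
    a ⊕ ((negate b) ⊕ b)  ≡⟨ cong (a ⊕_) (⊕-inverseˡ b) ⟩
    a ⊕ zero         ≡⟨ ⊕-identityʳ a ⟩
    a                ∎

  ⊕-⊖-cancel : (a b : Fin n) → (a ⊕ b) ⊖ b ≡ a
  ⊕-⊖-cancel a b = begin
    (a ⊕ b) ⊕ (negate b)  ≡⟨ ⊕-assoc a b (negate b) ⟩
    a ⊕ (b ⊕ (negate b))  ≡⟨ cong (a ⊕_) (trans (⊕-comm b (negate b)) (⊕-inverseˡ b)) ⟩
    a ⊕ zero         ≡⟨ ⊕-identityʳ a ⟩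
    a                ∎

  a≡c⊕b⇒a⊖b≡c : ∀ {a b c : Fin n} → a ≡ c ⊕ b → a ⊖ b ≡ c
  a≡c⊕b⇒a⊖b≡c {b = b} {c} refl = ⊕-⊖-cancel c b

  ⊖-cancelʳ : ∀ {a a′ b : Fin n} → a ⊖ b ≡ a′ ⊖ b → a ≡ a′
  ⊖-cancelʳ {a} {a′} {b} eq = begin
    a                ≡⟨ ⊖-⊕-cancel a b ⟨
    (a ⊖ b) ⊕ b      ≡⟨ cong (_⊕ b) eq ⟩
    (a′ ⊖ b) ⊕ b     ≡⟨ ⊖-⊕-cancel a′ b ⟩
    a′               ∎

  a⊖[a⊖b]≡b : (a b : Fin n) → a ⊖ (a ⊖ b) ≡ b
  a⊖[a⊖b]≡b a b = a≡c⊕b⇒a⊖b≡c (sym (trans (⊕-comm b (a ⊖ b)) (⊖-⊕-cancel a b)))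

  ⊖-cancelˡ : ∀ {a b b′ : Fin n} → a ⊖ b ≡ a ⊖ b′ → b ≡ b′
  ⊖-cancelˡ {a} {b} {b′} eq = begin
    b                ≡⟨ a⊖[a⊖b]≡b a b ⟨
    a ⊖ (a ⊖ b)      ≡⟨ cong (a ⊖_) eq ⟩
    a ⊖ (a ⊖ b′)     ≡⟨ a⊖[a⊖b]≡b a b′ ⟩
    b′               ∎

  [a⊕c]⊖[b⊕c]≡a⊖b : (a b c : Fin n) → (a ⊕ c) ⊖ (b ⊕ c) ≡ a ⊖ b
  [a⊕c]⊖[b⊕c]≡a⊖b a b c = a≡c⊕b⇒a⊖b≡c (begin
    a ⊕ c                ≡⟨ cong (_⊕ c) (⊖-⊕-cancel a b) ⟨
    ((a ⊖ b) ⊕ b) ⊕ c    ≡⟨ ⊕-assoc (a ⊖ b) b c ⟩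
    (a ⊖ b) ⊕ (b ⊕ c)    ∎)

  inc≡⊕1 : (a : Fin n) → inc a ≡ a ⊕ inc zero
  inc≡⊕1 a = toℕ-injective (begin
    toℕ (inc a)               ≡⟨ toℕ-fromℕ< _ ⟩
    suc (toℕ a) % n           ≡⟨ cong (_% n) (+-comm 1 (toℕ a)) ⟩
    (toℕ a + 1) % n           ≡⟨ %-absorbʳ (toℕ a) 1 n ⟨
    (toℕ a + 1 % n) % n       ≡⟨ cong (λ v → (toℕ a + v) % n) (toℕ-fromℕ< _) ⟨
    (toℕ a + toℕ (inc {n} zero)) % n ≡⟨ toℕ-⊕ a (inc zero) ⟨
    toℕ (a ⊕ inc zero)        ∎)

  inc⊖inc : (a b : Fin n) → inc a ⊖ inc b ≡ a ⊖ b
  inc⊖inc a b = begin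
    inc a ⊖ inc b                  ≡⟨ cong₂ _⊖_ (inc≡⊕1 a) (inc≡⊕1 b) ⟩
    (a ⊕ inc zero) ⊖ (b ⊕ inc zero) ≡⟨ [a⊕c]⊖[b⊕c]≡a⊖b a b (inc zero) ⟩
    a ⊖ b                          ∎

rowOccupied colOccupied symOccupied : ∀ {n} → TSet n → Fin n → Bool
rowOccupied D a = any₂ λ b x → D a b x
colOccupied D b = any₂ λ a x → D a b x
symOccupied D x = any₂ λ a b → D a b x

⊆B⇒≡⊕ : ∀ {k} {D : TSet (suc k)} → D ⊆ B (suc k) → ∀ {a b x} → D ∋ (a , b , x) → x ≡ a ⊕ b
⊆B⇒≡⊕ D⊆B {a} {b} {x} abx with x ≟ (a ⊕ b) | D⊆B a b x abx
... | yes x≡a⊕b | _ = x≡a⊕b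

record IsPartialTransversal (n : ℕ) (D : TSet n) : Set where
  field
    ⊆B    : D ⊆ B n
    row≤1 : ∀ r → rowCount D r ≤ 1
    col≤1 : ∀ c → colCount D c ≤ 1
    sym≤1 : ∀ e → symCount D e ≤ 1

  row-unique : ∀ {a b x b′ x′} → D ∋ (a , b , x) → D ∋ (a , b′ , x′) → b ≡ b′ × x ≡ x′
  row-unique {a} = count₂≤1⇒unique (λ b x → D a b x) (row≤1 a)

  col-unique : ∀ {a b x a′ x′} → D ∋ (a , b , x) → D ∋ (a′ , b , x′) → a ≡ a′ × x ≡ x′
  col-unique {b = b} = count₂≤1⇒unique (λ a x → D a b x) (col≤1 b)

  sym-unique : ∀ {a b x a′ b′} → D ∋ (a , b , x) → D ∋ (a′ , b′ , x) → a ≡ a′ × b ≡ b′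
  sym-unique {x = x} = count₂≤1⇒unique (λ a b → D a b x) (sym≤1 x)

  card≡countF-rowOccupied : card D ≡ countF (rowOccupied D)
  card≡countF-rowOccupied = begin
    card D                                   ≡⟨ sumF-cong (λ a → count₂≤1⇒≡indicator (D a) (row≤1 a)) ⟩
    sumF (λ a → indicator (rowOccupied D a)) ≡⟨ countF≡sumF-indicator (rowOccupied D) ⟨
    countF (rowOccupied D)                   ∎

  card≡countF-symOccupied : card D ≡ countF (symOccupied D)
  card≡countF-symOccupied = begin
    card D                                   ≡⟨ card≡sumF-symCount ⟩
    sumF (symCount D)                        ≡⟨ sumF-cong (λ x → count₂≤1⇒≡indicator (λ a b → D a b x) (sym≤1 x)) ⟩
    sumF (λ x → indicator (symOccupied D x)) ≡⟨ countF≡sumF-indicator (symOccupied D) ⟨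
    countF (symOccupied D)                   ∎
    where
    card≡sumF-symCount : card D ≡ sumF (symCount D)
    card≡sumF-symCount = begin
      card D                                                            ≡⟨ sumF-cong (λ a → sumF-cong λ b → countF≡sumF-indicator (D a b)) ⟩
      sumF (λ a → sumF λ b → sumF λ x → indicator (D a b x))            ≡⟨ sumF-cong (λ a → sumF-comm λ b x → indicator (D a b x)) ⟩
      sumF (λ a → sumF λ x → sumF λ b → indicator (D a b x))            ≡⟨ sumF-comm (λ a x → sumF λ b → indicator (D a b x)) ⟩
      sumF (λ x → sumF λ a → sumF λ b → indicator (D a b x))            ≡⟨ sumF-cong (λ x → sumF-cong λ a → countF≡sumF-indicator (λ b → D a b x)) ⟨
      sumF (symCount D)                                                 ∎

open IsPartialTransversal

transversal⇒partial : ∀ {n T} → IsTransversal n T → IsPartialTransversal n T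
transversal⇒partial (T⊆B , _ , rows , cols , syms) = record
  { ⊆B = T⊆B ; row≤1 = ≤-reflexive ∘ rows ; col≤1 = ≤-reflexive ∘ cols ; sym≤1 = ≤-reflexive ∘ syms }

partial-⊆ : ∀ {n S T} → S ⊆ T → IsPartialTransversal n T → IsPartialTransversal n S
partial-⊆ S⊆T T-partial = record
  { ⊆B    = λ r c e → ⊆B T-partial r c e ∘ S⊆T r c e
  ; row≤1 = λ a → ≤-trans (count₂-mono (S⊆T a)) (row≤1 T-partial a)
  ; col≤1 = λ b → ≤-trans (count₂-mono λ a → S⊆T a b) (col≤1 T-partial b)
  ; sym≤1 = λ x → ≤-trans (count₂-mono λ a b → S⊆T a b x) (sym≤1 T-partial x)
  }

-- (a , b , x) ∈ D contributes all translates of (0 , a , x): the row of D is read off as c ⊖ r,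
-- its column as e ⊖ c and its symbol as e ⊖ r.
circulant : ∀ {k} → TSet (suc k) → TSet (suc k)
circulant D r c e = D (c ⊖ r) (e ⊖ c) (e ⊖ r)

circulant-inc : ∀ {k} (D : TSet (suc k)) r c e → circulant D (inc r) (inc c) (inc e) ≡ circulant D r c e
circulant-inc D r c e rewrite inc⊖inc c r | inc⊖inc e c | inc⊖inc e r = refl

module _ {k} {D : TSet (suc k)} (D⊆B : D ⊆ B (suc k)) where

  circulant-translate : ∀ {a b x} r → D ∋ (a , b , x) → circulant D ∋ (r , a ⊕ r , x ⊕ r)
  circulant-translate {a} {b} {x} r abx = trans translate abx
    where
    [x⊕r]⊖[a⊕r]≡b : (x ⊕ r) ⊖ (a ⊕ r) ≡ b
    [x⊕r]⊖[a⊕r]≡b = trans ([a⊕c]⊖[b⊕c]≡a⊖b x a r)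
                          (a≡c⊕b⇒a⊖b≡c (trans (⊆B⇒≡⊕ D⊆B abx) (⊕-comm a b)))

    translate : circulant D r (a ⊕ r) (x ⊕ r) ≡ D a b x
    translate = trans (cong₂ (λ a′ b′ → D a′ b′ ((x ⊕ r) ⊖ r)) (⊕-⊖-cancel a r) [x⊕r]⊖[a⊕r]≡b)
                      (cong (D a b) (⊕-⊖-cancel x r))

  filled-circulant : ∀ r c → filled (circulant D) r c ≡ rowOccupied D (c ⊖ r)
  filled-circulant r c = ⇔→≡ {z = true} (mk⇔ to from)
    where
    to : filled (circulant D) r c ≡ true → rowOccupied D (c ⊖ r) ≡ true
    to rc-filled with anyF-elim (circulant D r c) rc-filled
    ... | e , rce = any₂-intro (D (c ⊖ r)) (e ⊖ c) (e ⊖ r) rce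

    from : rowOccupied D (c ⊖ r) ≡ true → filled (circulant D) r c ≡ true
    from occupied with any₂-elim (D (c ⊖ r)) occupied
    ... | b , x , abx = anyF-intro (circulant D r c) (x ⊕ r)
      (subst (λ c′ → circulant D r c′ (x ⊕ r) ≡ true) (⊖-⊕-cancel c r) (circulant-translate r abx))

  rowHas-circulant : ∀ r e → rowHas (circulant D) r e ≡ symOccupied D (e ⊖ r)
  rowHas-circulant r e = ⇔→≡ {z = true} (mk⇔ to from)
    where
    to : rowHas (circulant D) r e ≡ true → symOccupied D (e ⊖ r) ≡ true
    to has with anyF-elim (λ c → circulant D r c e) has
    ... | c , rce = any₂-intro (λ a b → D a b (e ⊖ r)) (c ⊖ r) (e ⊖ c) rce

    from : symOccupied D (e ⊖ r) ≡ true → rowHas (circulant D) r e ≡ true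
    from occupied with any₂-elim (λ a b → D a b (e ⊖ r)) occupied
    ... | a , b , abx = anyF-intro (λ c → circulant D r c e) (a ⊕ r)
      (subst (λ e′ → circulant D r (a ⊕ r) e′ ≡ true) (⊖-⊕-cancel e r) (circulant-translate r abx))

  colHas-circulant : ∀ c e → colHas (circulant D) c e ≡ colOccupied D (e ⊖ c)
  colHas-circulant c e = ⇔→≡ {z = true} (mk⇔ to from)
    where
    to : colHas (circulant D) c e ≡ true → colOccupied D (e ⊖ c) ≡ true
    to has with anyF-elim (λ r → circulant D r c e) has
    ... | r , rce = any₂-intro (λ a x → D a (e ⊖ c) x) (c ⊖ r) (e ⊖ r) rce

    from : colOccupied D (e ⊖ c) ≡ true → colHas (circulant D) c e ≡ true
    from occupied with any₂-elim (λ a x → D a (e ⊖ c) x) occupied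
    ... | a , x , abx = anyF-intro (λ r → circulant D r c e) (c ⊖ a)
      (subst₂ (λ c′ e′ → circulant D (c ⊖ a) c′ e′ ≡ true) a⊕[c⊖a]≡c x⊕[c⊖a]≡e (circulant-translate (c ⊖ a) abx))
      where
      a⊕[c⊖a]≡c : a ⊕ (c ⊖ a) ≡ c
      a⊕[c⊖a]≡c = trans (⊕-comm a (c ⊖ a)) (⊖-⊕-cancel c a)

      x⊕[c⊖a]≡e : x ⊕ (c ⊖ a) ≡ e
      x⊕[c⊖a]≡e = begin
        x ⊕ (c ⊖ a)                ≡⟨ cong (_⊕ (c ⊖ a)) (⊆B⇒≡⊕ D⊆B abx) ⟩
        (a ⊕ (e ⊖ c)) ⊕ (c ⊖ a)    ≡⟨ cong (_⊕ (c ⊖ a)) (⊕-comm a (e ⊖ c)) ⟩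
        ((e ⊖ c) ⊕ a) ⊕ (c ⊖ a)    ≡⟨ ⊕-assoc (e ⊖ c) a (c ⊖ a) ⟩
        (e ⊖ c) ⊕ (a ⊕ (c ⊖ a))    ≡⟨ cong ((e ⊖ c) ⊕_) a⊕[c⊖a]≡c ⟩
        (e ⊖ c) ⊕ c                ≡⟨ ⊖-⊕-cancel e c ⟩
        e                          ∎

module _ {k} {D : TSet (suc k)} (D-partial : IsPartialTransversal (suc k) D) where

  circulant-isPartialLatinSquare : IsPartialLatinSquare (suc k) (circulant D)
  circulant-isPartialLatinSquare =
      (λ r c → unique⇒countF≤1 (circulant D r c) λ e e′ rce rce′ → ⊖-cancelʳ {b = r} (proj₂ (row-unique D-partial rce rce′)))
    , (λ r e → unique⇒countF≤1 (λ c → circulant D r c e) λ c c′ rce rc′e → ⊖-cancelʳ {b = r} (proj₁ (sym-unique D-partial rce rc′e)))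
    , (λ c e → unique⇒countF≤1 (λ r → circulant D r c e) λ r r′ rce r′ce → ⊖-cancelˡ {a = c} (proj₁ (col-unique D-partial rce r′ce)))

  circulant-homogeneous :
    (∀ r → (countF λ c → filled (circulant D) r c) ≡ card D) ×
    (∀ c → (countF λ r → filled (circulant D) r c) ≡ card D) ×
    (∀ e → symCount (circulant D) e ≡ card D)
  circulant-homogeneous = rows , cols , symbols
    where
    filled≡ : ∀ r c → filled (circulant D) r c ≡ rowOccupied D (c ⊖ r)
    filled≡ = filled-circulant (⊆B D-partial)

    rows : ∀ r → (countF λ c → filled (circulant D) r c) ≡ card D
    rows r = begin
      countF (λ c → filled (circulant D) r c)  ≡⟨ countF-cong (filled≡ r) ⟩
      countF (λ c → rowOccupied D (c ⊖ r))     ≡⟨ countF-permute (rowOccupied D) (_⊖ r) (_⊕ r) (λ c → ⊕-⊖-cancel c r) (λ c → ⊖-⊕-cancel c r) ⟩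
      countF (rowOccupied D)                   ≡⟨ card≡countF-rowOccupied D-partial ⟨
      card D                                   ∎

    cols : ∀ c → (countF λ r → filled (circulant D) r c) ≡ card D
    cols c = begin
      countF (λ r → filled (circulant D) r c)  ≡⟨ countF-cong (λ r → filled≡ r c) ⟩
      countF (λ r → rowOccupied D (c ⊖ r))     ≡⟨ countF-permute (rowOccupied D) (c ⊖_) (c ⊖_) (a⊖[a⊖b]≡b c) (a⊖[a⊖b]≡b c) ⟩
      countF (rowOccupied D)                   ≡⟨ card≡countF-rowOccupied D-partial ⟨
      card D                                   ∎

    symbols : ∀ e → symCount (circulant D) e ≡ card D
    symbols e = begin
      symCount (circulant D) e                           ≡⟨ sumF-cong (λ r → countF≤1⇒≡indicator (λ c → circulant D r c e) (proj₁ (proj₂ circulant-isPartialLatinSquare) r e)) ⟩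
      sumF (λ r → indicator (rowHas (circulant D) r e)) ≡⟨ sumF-cong (λ r → cong indicator (rowHas-circulant (⊆B D-partial) r e)) ⟩
      sumF (λ r → indicator (symOccupied D (e ⊖ r)))    ≡⟨ countF≡sumF-indicator (λ r → symOccupied D (e ⊖ r)) ⟨
      countF (λ r → symOccupied D (e ⊖ r))              ≡⟨ countF-permute (symOccupied D) (e ⊖_) (e ⊖_) (a⊖[a⊖b]≡b e) (a⊖[a⊖b]≡b e) ⟩
      countF (symOccupied D)                            ≡⟨ card≡countF-symOccupied D-partial ⟨
      card D                                            ∎

_∖_ : ∀ {n} → TSet n → TSet n → TSet n
(T ∖ S) r c e = T r c e ∧ not (S r c e)

∖-⊆ : ∀ {n} {T S : TSet n} → (T ∖ S) ⊆ T
∖-⊆ {T = T} r c e with T r c e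
... | true = λ _ → refl

∖-∌ : ∀ {n} {T S : TSet n} {r c e} → (T ∖ S) ∋ (r , c , e) → S ∋ (r , c , e) → ⊥
∖-∌ {T = T} {r = r} {c} {e} T∖S∋ S∋ rewrite S∋ | ∧-zeroʳ (T r c e) = case T∖S∋ of λ ()

module _ {n} {T S : TSet n} (T-transversal : IsTransversal n T) (S⊆T : S ⊆ T) where

  private
    rows≡1 : ∀ r → rowCount T r ≡ 1
    rows≡1 = proj₁ (proj₂ (proj₂ T-transversal))

    cols≡1 : ∀ c → colCount T c ≡ 1
    cols≡1 = proj₁ (proj₂ (proj₂ (proj₂ T-transversal)))

    syms≡1 : ∀ e → symCount T e ≡ 1
    syms≡1 = proj₂ (proj₂ (proj₂ (proj₂ T-transversal)))

  rowOccupied-∖ : ∀ a → rowOccupied (T ∖ S) a ≡ not (rowOccupied S a)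
  rowOccupied-∖ a = any₂-∖ (T a) (rows≡1 a) (S a) (S⊆T a)

  colOccupied-∖ : ∀ b → colOccupied (T ∖ S) b ≡ not (colOccupied S b)
  colOccupied-∖ b = any₂-∖ (λ a x → T a b x) (cols≡1 b) (λ a x → S a b x) (λ a x → S⊆T a b x)

  symOccupied-∖ : ∀ x → symOccupied (T ∖ S) x ≡ not (symOccupied S x)
  symOccupied-∖ x = any₂-∖ (λ a b → T a b x) (syms≡1 x) (λ a b → S a b x) (λ a b → S⊆T a b x)

  card-∖ : card (T ∖ S) ≡ n ∸ card S
  card-∖ = begin
    card (T ∖ S)                       ≡⟨ card≡countF-rowOccupied (partial-⊆ ∖-⊆ T-partial) ⟩
    countF (rowOccupied (T ∖ S))       ≡⟨ countF-cong rowOccupied-∖ ⟩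
    countF (not ∘ rowOccupied S)       ≡⟨ countF-not (rowOccupied S) ⟩
    n ∸ countF (rowOccupied S)         ≡⟨ cong (n ∸_) (card≡countF-rowOccupied (partial-⊆ S⊆T T-partial)) ⟨
    n ∸ card S                         ∎
    where
    T-partial : IsPartialTransversal n T
    T-partial = transversal⇒partial T-transversal

module StablyIntersectingTransversals {m k t} (T : Fin (suc m) → TSet (suc k))
  (transversal : ∀ α → IsTransversal (suc k) (T α)) (stable : IntersectStably T t) where

  n : ℕ
  n = suc k

  S : TSet n
  S = ⋂ T

  S⊆T : ∀ α → S ⊆ T α
  S⊆T α r c e S∋ = allF-elim (λ i → T i r c e) S∋ α

  D : Fin (suc m) → TSet n
  D α = T α ∖ S

  D-partial : ∀ α → IsPartialTransversal n (D α)
  D-partial α = partial-⊆ ∖-⊆ (transversal⇒partial (transversal α))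

  card-D : ∀ α → card (D α) ≡ n ∸ t
  card-D α = trans (card-∖ (transversal α) (S⊆T α)) (cong (n ∸_) (proj₁ stable))

  L : Fin (suc m) → TSet n
  L α = circulant (D α)

  filled-L : ∀ α r c → filled (L α) r c ≡ not (rowOccupied S (c ⊖ r))
  filled-L α r c = trans (filled-circulant (⊆B (D-partial α)) r c) (rowOccupied-∖ (transversal α) (S⊆T α) (c ⊖ r))

  rowHas-L : ∀ α r e → rowHas (L α) r e ≡ not (symOccupied S (e ⊖ r))
  rowHas-L α r e = trans (rowHas-circulant (⊆B (D-partial α)) r e) (symOccupied-∖ (transversal α) (S⊆T α) (e ⊖ r))

  colHas-L : ∀ α c e → colHas (L α) c e ≡ not (colOccupied S (e ⊖ c))
  colHas-L α c e = trans (colHas-circulant (⊆B (D-partial α)) c e) (colOccupied-∖ (transversal α) (S⊆T α) (e ⊖ c))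

  L-disjoint : ∀ α β → α ≢ β → ∀ r c e → L α ∋ (r , c , e) → L β r c e ≡ false
  L-disjoint α β α≢β r c e Lα∋ = ¬-not λ Lβ∋ →
    ∖-∌ {T = T α} {S} Lα∋ (proj₂ stable α β α≢β (c ⊖ r) (e ⊖ c) (e ⊖ r)
                                (∖-⊆ {T = T α} {S} _ _ _ Lα∋) (∖-⊆ {T = T β} {S} _ _ _ Lβ∋))

  L-homogeneous : IsHomogeneous (n ∸ t) L
  L-homogeneous α =
    let rows , cols , symbols = circulant-homogeneous (D-partial α)
    in (λ r → trans (rows r) (card-D α)) , (λ c → trans (cols c) (card-D α)) , (λ e → trans (symbols e) (card-D α))

  L-volume : ∀ α → (sumF λ r → countF λ c → filled (L α) r c) ≡ n * (n ∸ t)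
  L-volume α = trans (sumF-cong (proj₁ (L-homogeneous α))) (sumF-const {n} (n ∸ t))

  L-latinTrade : IsLatinTrade (suc m) n (n * (n ∸ t)) L
  L-latinTrade =
      (λ α → circulant-isPartialLatinSquare (D-partial α))
    , (λ α β r c → trans (filled-L α r c) (sym (filled-L β r c)))
    , L-volume
    , L-disjoint
    , (λ α β r e → trans (rowHas-L α r e) (sym (rowHas-L β r e)))
    , (λ α β c e → trans (colHas-L α c e) (sym (colHas-L β c e)))

  L-circulant : IsCirculant L
  L-circulant α r c e Lα∋ = trans (circulant-inc (D α) r c e) Lα∋

theorem9 : (μ n t : ℕ) (T : Fin μ → TSet n) →
    (∀ i → IsTransversal n (T i)) → IntersectStably T t →
    Σ (Fin μ → TSet n) λ L → Σ ℕ λ s →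
    IsLatinTrade μ n s L × IsCirculant L × IsHomogeneous (n ∸ t) L
theorem9 μ zero t T _ _ =
  (λ _ _ _ _ → false) , 0 ,
  ((λ _ → (λ ()) , (λ ()) , (λ ())) , (λ _ _ ()) , (λ _ → refl) , (λ _ _ _ ()) , (λ _ _ ()) , (λ _ _ ())) ,
  (λ _ ()) , (λ _ → (λ ()) , (λ ()) , (λ ()))
theorem9 zero (suc k) t T _ _ =
  (λ ()) , 0 , ((λ ()) , (λ ()) , (λ ()) , (λ ()) , (λ ()) , (λ ())) , (λ ()) , (λ ())
theorem9 (suc m) (suc k) t T transversal stable =
  L , suc k * (suc k ∸ t) , L-latinTrade , L-circulant , L-homogeneous
  where open StablyIntersectingTransversals T transversal stable
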